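{- Let $G=(V,E,w)$ be a directed graph with positive edge weights, $s\in V$, and $T$ an $s$-arborescence of $G$. Define $C_0=\{s\}$, let $P_1$ be the set of subtrees (connected components, ignoring directions) of $T$ after removing $s$, and for $i\ge1$ let $C_i$ consist of one chosen centroid of each $U\in P_i$ and let $P_{i+1}$ be the set of all subtrees obtained by removing the chosen centroid from $U$, over all $U\in P_i$. For $i\ge1$ with $P_i\ne\emptyset$, let $G_i$ be the directed graph on vertex set $V\cup\{t_i\}$ ($t_i$ a new vertex) with edge set $E_1\cup E_2\cup E_3$, where: $E_1=E\cap\bigcup_{U\in P_i}(U\times U)$ with capacities equal to the original weights; $E_2=\{(s,v):(x,v)\in E\setminus E_1\}$, where the edge $(s,v)$ arising from $(x,v)$ has capacity $w(x,v)$; $E_3=\{(u,t_i):u\in C_i\}$ with infinite capacities. Let $f^*_i$ be a maximum $s$-$t_i$ flow in $G_i$. Then for every $U\in P_i$ with chosen centroid $u$, the amount of flow $f^*_i$ puts on the edge $(u,t_i)$ equals the minimum, over all $A\subseteq V$ with $V\setminus U\subseteq A$ and $u\notin A$, of the total weight in $G$ of edges from $A$ to $V\setminus A$.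
   Context: An $s$-arborescence is a directed spanning tree rooted at $s$ with all edges directed away from $s$. A centroid of a tree $U$ (viewed as undirected) is a vertex whose removal leaves connected components each having at most $|U|/2$ vertices.
   Formalization: The edge weights of G are positive rationals, so the capacities and flow values in each network $G_i$ are rational as well. -}

module Defs where

open import Data.Nat using (ℕ; zero; suc; _*_)
import Data.Nat as ℕ
open import Data.Fin using (Fin; zero; suc)
open import Data.Fin.Subset using (Subset; _∈_; _∉_; _-_; ⁅_⁆; ∁; ∣_∣)
open import Data.Vec using (lookup)
open import Data.Bool using (Bool; true; false; if_then_else_; _∧_; not)
open import Data.Rational using (ℚ; 0ℚ; _+_; _≤_; _<_)
open import Data.Product using (Σ; ∃; ∃-syntax; _×_; _,_)
open import Data.Sum using (_⊎_)
open import Relation.Binary.PropositionalEquality using (_≡_; _≢_)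
open import Relation.Nullary using (¬_)

∑ : ∀ {n} → (Fin n → ℚ) → ℚ
∑ {zero}  f = 0ℚ
∑ {suc n} f = f zero + ∑ (λ i → f (suc i))

-- Weighted digraph G = (V, E, w) with V = Fin n.
-- w x y is the weight of edge (x,y); (x,y) ∈ E iff 0 < w x y
-- (w x y = 0 encodes "no edge"), so every edge has positive weight.

Weights : ℕ → Set
Weights n = Fin n → Fin n → ℚ

NonNeg : ∀ {n} → Weights n → Set
NonNeg w = ∀ x y → 0ℚ ≤ w x y

Digraph : ℕ → Set₁
Digraph n = Fin n → Fin n → Set

data DReach {n} (T : Digraph n) : Fin n → Fin n → Set where
  here : ∀ {x} → DReach T x x
  step : ∀ {x y z} → DReach T x y → T y z → DReach T x z

record IsArborescence {n} (w : Weights n) (s : Fin n) (T : Digraph n) : Set where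
  field
    sub-E     : ∀ x y → T x y → 0ℚ < w x y
    reach     : ∀ v → DReach T s v
    root-in   : ∀ x → ¬ T x s
    unique-in : ∀ v → v ≢ s → ∃[ x ] (T x v × (∀ y → T y v → y ≡ x))

Adj : ∀ {n} → Digraph n → Fin n → Fin n → Set
Adj T x y = T x y ⊎ T y x

data Conn {n} (T : Digraph n) (S : Subset n) : Fin n → Fin n → Set where
  here : ∀ {x} → x ∈ S → Conn T S x x
  step : ∀ {x y z} → Conn T S x y → Adj T y z → z ∈ S → Conn T S x z

_⊆ₛ_ : ∀ {n} → Subset n → Subset n → Set
A ⊆ₛ B = ∀ {x} → x ∈ A → x ∈ B

record IsComponent {n} (T : Digraph n) (S W : Subset n) : Set where
  field
    sub       : W ⊆ₛ S
    nonempty  : ∃[ x ] (x ∈ W)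
    connected : ∀ {x y} → x ∈ W → y ∈ W → Conn T S x y
    closed    : ∀ {x y} → x ∈ W → y ∈ S → Adj T x y → y ∈ W

record IsCentroid {n} (T : Digraph n) (U : Subset n) (u : Fin n) : Set where
  field
    mem     : u ∈ U
    balance : ∀ W → IsComponent T (U - u) W → 2 * ∣ W ∣ ℕ.≤ ∣ U ∣

-- The centroid hierarchy.  χ i U is the centroid chosen for U ∈ P_i.
-- P i U  means  U ∈ P_i  (for i ≥ 1).

data P {n} (T : Digraph n) (s : Fin n) (χ : ℕ → Subset n → Fin n)
       : ℕ → Subset n → Set where
  P₁   : ∀ {U} → IsComponent T (∁ ⁅ s ⁆) U → P T s χ 1 U
  Pstep : ∀ {i U W} → P T s χ i U → IsComponent T (U - χ i U) W →
          P T s χ (suc i) W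

C : ∀ {n} → Digraph n → Fin n → (ℕ → Subset n → Fin n) → ℕ → Fin n → Set
C T s χ i u = ∃[ U ] (P T s χ i U × χ i U ≡ u)

SamePart : ∀ {n} → Digraph n → Fin n → (ℕ → Subset n → Fin n) → ℕ →
           Fin n → Fin n → Set
SamePart T s χ i x y = ∃[ U ] (P T s χ i U × x ∈ U × y ∈ U)

-- A flow is given by its values on the
-- three kinds of edges:
--   e₁ x y : flow on the E₁-edge (x,y)            (capacity w x y)
--   e₂ x v : flow on the E₂-edge (s,v) arising from the original edge
--            (x,v) ∈ E ∖ E₁                         (capacity w x v)
--   e₃ u   : flow on the E₃-edge (u,t_i), u ∈ C_i   (capacity ∞)
-- Pairs that are not edges of the respective kind carry flow 0.

record Flow (n : ℕ) : Set where
  field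
    e₁ : Fin n → Fin n → ℚ
    e₂ : Fin n → Fin n → ℚ
    e₃ : Fin n → ℚ
open Flow public

record Feasible {n} (w : Weights n) (T : Digraph n) (s : Fin n)
                (χ : ℕ → Subset n → Fin n) (i : ℕ) (f : Flow n) : Set where
  field
    e₁-nonneg : ∀ x y → 0ℚ ≤ e₁ f x y
    e₁-cap    : ∀ x y → e₁ f x y ≤ w x y
    e₁-none   : ∀ x y → ¬ SamePart T s χ i x y → e₁ f x y ≡ 0ℚ
    e₂-nonneg : ∀ x v → 0ℚ ≤ e₂ f x v
    e₂-cap    : ∀ x v → e₂ f x v ≤ w x v
    e₂-none   : ∀ x v → SamePart T s χ i x v → e₂ f x v ≡ 0ℚ
    e₃-nonneg : ∀ u → 0ℚ ≤ e₃ f u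
    e₃-none   : ∀ u → ¬ C T s χ i u → e₃ f u ≡ 0ℚ
    -- flow conservation at every vertex of V other than s
    -- (E₂-edges leave s, so they only contribute inflow at v ≠ s)
    conserve  : ∀ v → v ≢ s →
      ∑ (λ x → e₁ f x v) + ∑ (λ x → e₂ f x v) ≡ ∑ (λ y → e₁ f v y) + e₃ f v

-- value of the s-t_i flow = net flow into t_i (t_i has no out-edges)
value : ∀ {n} → Flow n → ℚ
value f = ∑ (e₃ f)

record IsMaxFlow {n} (w : Weights n) (T : Digraph n) (s : Fin n)
                 (χ : ℕ → Subset n → Fin n) (i : ℕ) (f : Flow n) : Set where
  field
    feasible : Feasible w T s χ i f
    maximal  : ∀ g → Feasible w T s χ i g → value g ≤ value f

cutWeight : ∀ {n} → Weights n → Subset n → ℚ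
cutWeight w A =
  ∑ (λ x → ∑ (λ y → if lookup A x ∧ not (lookup A y) then w x y else 0ℚ))

Admissible : ∀ {n} → Subset n → Fin n → Subset n → Set
Admissible U u A = (∀ x → x ∉ U → x ∈ A) × u ∉ A

IsMinCut : ∀ {n} → Weights n → Subset n → Fin n → ℚ → Set
IsMinCut w U u q =
  (∃[ A ] (Admissible U u A × cutWeight w A ≡ q)) ×
  (∀ A → Admissible U u A → q ≤ cutWeight w A)

-- This is max-flow/min-cut localised to one part U ∈ P_i with chosen vertex u.  It only needs
-- that the parts of P_i are pairwise disjoint, avoid s and contain their chosen vertices.
--
-- Weak duality: for an admissible cut A the sink side V ∖ A lies inside U.  Summing flow
-- conservation over it, the only E₃-edge leaving it is (u, t_i), since u is the only chosen
-- vertex in U, and an edge (x, v) entering it carries at most w x v: in E₁ if x ∈ U, and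
-- through its E₂-copy (s, v) otherwise.
--
-- Strong duality: let R be the set of vertices of U reachable in the residual network of a
-- maximum flow, starting from unsaturated E₂-edges.  If u ∈ R, pushing a small enough ε along
-- a shortest augmenting path and on to t_i gives a feasible flow of larger value.  So u ∉ R,
-- and A = (V ∖ U) ∪ R is admissible, all its edges into U ∖ R are saturated and none of the
-- edges back carry flow, so the flow on (u, t_i) equals the weight of A.

module Submission where

open import Defs
open import Data.Nat using (ℕ)
open import Data.Fin using (Fin)
open import Data.Fin.Subset using (Subset)

open import Algebra.Bundles using (CommutativeMonoid)
open import Data.Bool using (Bool; true; false; if_then_else_; _∧_; not)
open import Data.Bool.Properties using (not-injective)
open import Data.Empty using (⊥)
open import Data.Fin using (zero; suc; _≟_)
open import Data.Fin.Properties using (all?; any?; ¬∀⟶∃¬)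
import Data.Fin.Subset as Subset
open import Data.Fin.Subset using (_∈_; _∉_; ⁅_⁆; ∣_∣)
open import Data.Fin.Subset.Properties
  using (_∈?_; ∣p∣≤n; p⊂q⇒∣p∣<∣q∣; ⊆-antisym; p─q⊆p; x∈∁p⇒x∉p; x∉⁅y⁆⇒x≢y)
open import Data.Nat using (zero; suc)
import Data.Nat as ℕ
import Data.Nat.Properties as ℕ
open import Data.Product using (_×_; _,_; ∃-syntax; proj₁; proj₂)
open import Data.Rational using (ℚ; 0ℚ; _+_; _-_; -_; _≤_; _<_; _⊓_)
import Data.Rational.Properties as ℚ
open import Data.Sum using (_⊎_; inj₁; inj₂; [_,_])
open import Data.Vec using (lookup; tabulate)
open import Data.Vec.Properties using (lookup⇒[]=; []=⇒lookup; lookup∘tabulate)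
open import Function using (_∘_; flip)
open import Level using (Level)
open import Relation.Binary.PropositionalEquality
  using (_≡_; _≢_; refl; sym; trans; cong; cong₂; subst; module ≡-Reasoning)
open import Relation.Nullary using (¬_; Dec; yes; no; does; contradiction)
open import Relation.Nullary.Decidable
  using (⌊_⌋; _→-dec_; _×-dec_; _⊎-dec_; ¬?; dec-true; dec-false; decidable-stable)
open import Relation.Unary using (Pred; Decidable; _⊆_)

open import Algebra.Properties.AbelianGroup ℚ.+-0-abelianGroup using (∙-cancelˡ; xyx⁻¹≈y)
open import Algebra.Properties.CommutativeSemigroup
  (CommutativeMonoid.commutativeSemigroup ℚ.+-0-commutativeMonoid)
  using (xy∙z≈xz∙y) renaming (interchange to +-interchange)

+-nonneg : ∀ {p q} → 0ℚ ≤ p → 0ℚ ≤ q → 0ℚ ≤ p + q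
+-nonneg {p} {q} 0≤p 0≤q = subst (_≤ p + q) (ℚ.+-identityʳ 0ℚ) (ℚ.+-mono-≤ 0≤p 0≤q)

p≤q+p : ∀ {p q} → 0ℚ ≤ q → p ≤ q + p
p≤q+p {p} {q} 0≤q = subst (_≤ q + p) (ℚ.+-identityˡ p) (ℚ.+-monoˡ-≤ p 0≤q)

p<q⇒0<q-p : ∀ {p q} → p < q → 0ℚ < q - p
p<q⇒0<q-p {p} {q} p<q = subst (_< q - p) (ℚ.+-inverseʳ p) (ℚ.+-monoˡ-< (- p) p<q)

p≤q⇒0≤q-p : ∀ {p q} → p ≤ q → 0ℚ ≤ q - p
p≤q⇒0≤q-p {p} {q} p≤q = subst (_≤ q - p) (ℚ.+-inverseʳ p) (ℚ.+-monoˡ-≤ (- p) p≤q)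

p-q≤p : ∀ p {q} → 0ℚ ≤ q → p - q ≤ p
p-q≤p p {q} 0≤q = subst (p - q ≤_) (ℚ.+-identityʳ p) (ℚ.+-monoʳ-≤ p (ℚ.neg-antimono-≤ 0≤q))

p+[q-p]≡q : ∀ p q → p + (q - p) ≡ q
p+[q-p]≡q p q = trans (sym (ℚ.+-assoc p q (- p))) (xyx⁻¹≈y p q)

p+r≤q : ∀ p {q r} → r ≤ q - p → p + r ≤ q
p+r≤q p {q} r≤q-p = ℚ.≤-trans (ℚ.+-monoʳ-≤ p r≤q-p) (ℚ.≤-reflexive (p+[q-p]≡q p q))

≤∧≮⇒≡ : ∀ {p q} → p ≤ q → ¬ p < q → p ≡ q
≤∧≮⇒≡ p≤q p≮q = ℚ.≤-antisym p≤q (ℚ.≮⇒≥ p≮q)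

0<⊓ : ∀ {p q} → 0ℚ < p → 0ℚ < q → 0ℚ < p ⊓ q
0<⊓ {p} {q} 0<p 0<q with ℚ.⊓-sel p q
... | inj₁ p⊓q≡p = subst (0ℚ <_) (sym p⊓q≡p) 0<p
... | inj₂ p⊓q≡q = subst (0ℚ <_) (sym p⊓q≡q) 0<q

∑-cong : ∀ {n} {f g : Fin n → ℚ} → (∀ x → f x ≡ g x) → ∑ f ≡ ∑ g
∑-cong {zero}  f≗g = refl
∑-cong {suc n} f≗g = cong₂ _+_ (f≗g zero) (∑-cong (λ x → f≗g (suc x)))

∑-zero : ∀ {n} (f : Fin n → ℚ) → (∀ x → f x ≡ 0ℚ) → ∑ f ≡ 0ℚ
∑-zero {zero}  f f≗0 = refl
∑-zero {suc n} f f≗0 =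
  trans (cong₂ _+_ (f≗0 zero) (∑-zero (λ x → f (suc x)) (λ x → f≗0 (suc x)))) (ℚ.+-identityˡ 0ℚ)

∑-distrib-+ : ∀ {n} (f g : Fin n → ℚ) → ∑ (λ x → f x + g x) ≡ ∑ f + ∑ g
∑-distrib-+ {zero}  f g = sym (ℚ.+-identityˡ 0ℚ)
∑-distrib-+ {suc n} f g =
  trans (cong (f zero + g zero +_) (∑-distrib-+ (λ x → f (suc x)) (λ x → g (suc x))))
        (+-interchange (f zero) (g zero) _ _)

∑-comm : ∀ {m n} (F : Fin m → Fin n → ℚ) → ∑ (λ x → ∑ (F x)) ≡ ∑ (λ y → ∑ (λ x → F x y))
∑-comm {zero}  F = sym (∑-zero (λ y → ∑ (λ x → F x y)) (λ _ → refl))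
∑-comm {suc m} F = trans (cong (∑ (F zero) +_) (∑-comm (λ x → F (suc x))))
                         (sym (∑-distrib-+ (F zero) (λ y → ∑ (λ x → F (suc x) y))))

∑-mono-≤ : ∀ {n} {f g : Fin n → ℚ} → (∀ x → f x ≤ g x) → ∑ f ≤ ∑ g
∑-mono-≤ {zero}  f≤g = ℚ.≤-refl
∑-mono-≤ {suc n} f≤g = ℚ.+-mono-≤ (f≤g zero) (∑-mono-≤ (λ x → f≤g (suc x)))

when : Bool → ℚ → ℚ
when b q = if b then q else 0ℚ

when-+ : ∀ b p q → when b (p + q) ≡ when b p + when b q
when-+ true  p q = refl
when-+ false p q = sym (ℚ.+-identityˡ 0ℚ)

when-∑ : ∀ {n} b (f : Fin n → ℚ) → when b (∑ f) ≡ ∑ (λ x → when b (f x))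
when-∑ true  f = refl
when-∑ false f = sym (∑-zero (λ x → when false (f x)) (λ _ → refl))

when-split : ∀ a b q → when a q ≡ when (a ∧ b) q + when (a ∧ not b) q
when-split true  true  q = sym (ℚ.+-identityʳ q)
when-split true  false q = sym (ℚ.+-identityˡ q)
when-split false b     q = sym (ℚ.+-identityˡ 0ℚ)

when-nonneg : ∀ b {q} → 0ℚ ≤ q → 0ℚ ≤ when b q
when-nonneg true  0≤q = 0≤q
when-nonneg false 0≤q = ℚ.≤-refl

when-zero : ∀ b → when b 0ℚ ≡ 0ℚ
when-zero true  = refl
when-zero false = refl

point : ∀ {n} → Fin n → ℚ → Fin n → ℚ
point z c y = when ⌊ y ≟ z ⌋ c

point-≢ : ∀ {n} (z : Fin n) c {y} → y ≢ z → point z c y ≡ 0ℚ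
point-≢ z c {y} y≢z with y ≟ z
... | yes y≡z = contradiction y≡z y≢z
... | no _    = refl

point-neg : ∀ {n} (z : Fin n) c y → point z (- c) y ≡ - point z c y
point-neg z c y with y ≟ z
... | yes _ = refl
... | no _  = refl

point-+-neg : ∀ {n} (z : Fin n) c y → point z c y + point z (- c) y ≡ 0ℚ
point-+-neg z c y = trans (cong (point z c y +_) (point-neg z c y)) (ℚ.+-inverseʳ (point z c y))

∑-point : ∀ {n} (z : Fin n) c → ∑ (point z c) ≡ c
∑-point {suc n} zero c    =
  trans (cong (c +_) (∑-zero {n} (λ y → point zero c (suc y)) (λ y → point-≢ zero c {suc y} λ ())))
        (ℚ.+-identityʳ c)
∑-point {suc n} (suc z) c = trans (ℚ.+-identityˡ _) (trans (∑-cong tail) (∑-point z c))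
  where
  tail : ∀ y → point (suc z) c (suc y) ≡ point z c y
  tail y with y ≟ z
  ... | yes _ = refl
  ... | no _  = refl

point₂ : ∀ {n} → Fin n → Fin n → ℚ → Fin n → Fin n → ℚ
point₂ a b c x y = point a (point b c y) x

∑-point₂ˡ : ∀ {n} (a b : Fin n) c y → ∑ (λ x → point₂ a b c x y) ≡ point b c y
∑-point₂ˡ a b c y = ∑-point a (point b c y)

∑-point₂ʳ : ∀ {n} (a b : Fin n) c x → ∑ (λ y → point₂ a b c x y) ≡ point a c x
∑-point₂ʳ a b c x =
  trans (sym (when-∑ ⌊ x ≟ a ⌋ (point b c))) (cong (when ⌊ x ≟ a ⌋) (∑-point b c))

point₂-≢ : ∀ {n} (a b : Fin n) c {x y} → ¬ (x ≡ a × y ≡ b) → point₂ a b c x y ≡ 0ℚ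
point₂-≢ a b c {x} {y} ne with x ≟ a | y ≟ b
... | yes x≡a | yes y≡b = contradiction (x≡a , y≡b) ne
... | no _    | _       = refl
... | yes _   | no _    = refl

+-point₂-≢ : ∀ {n} (a b : Fin n) c {x y} q → ¬ (x ≡ a × y ≡ b) → q + point₂ a b c x y ≡ q
+-point₂-≢ a b c q ne = trans (cong (q +_) (point₂-≢ a b c ne)) (ℚ.+-identityʳ q)

+-point₂-elim : ∀ {n} (P : Fin n → Fin n → ℚ → Set) {h : Fin n → Fin n → ℚ} {a b c} →
                P a b (h a b + c) → (∀ x y → P x y (h x y)) →
                ∀ x y → P x y (h x y + point₂ a b c x y)
+-point₂-elim P {h} {a} {b} {c} at-ab elsewhere x y with x ≟ a | y ≟ b
... | yes refl | yes refl = at-ab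
... | yes _    | no _     = subst (P x y) (sym (ℚ.+-identityʳ _)) (elsewhere x y)
... | no _     | _        = subst (P x y) (sym (ℚ.+-identityʳ _)) (elsewhere x y)

crossing : ∀ {n} → (Fin n → Fin n → ℚ) → (Fin n → Bool) → ℚ
crossing h A = ∑ λ x → ∑ λ y → when (A x ∧ not (A y)) (h x y)

module _ {n} {A : Fin n → Bool} where

  Leaves : (Fin n → Fin n → Set) → Set
  Leaves R = ∀ x y → A x ≡ true → A y ≡ false → R x y

  crossing-cong : ∀ {h h′} → Leaves (λ x y → h x y ≡ h′ x y) → crossing h A ≡ crossing h′ A
  crossing-cong {h} {h′} h≡h′ = ∑-cong λ x → ∑-cong λ y → pointwise x y
    where
    pointwise : ∀ x y → when (A x ∧ not (A y)) (h x y) ≡ when (A x ∧ not (A y)) (h′ x y)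
    pointwise x y with A x in ax | A y in ay
    ... | true  | false = h≡h′ x y ax ay
    ... | true  | true  = refl
    ... | false | _     = refl

  crossing-mono-≤ : ∀ {h h′} → Leaves (λ x y → h x y ≤ h′ x y) → crossing h A ≤ crossing h′ A
  crossing-mono-≤ {h} {h′} h≤h′ = ∑-mono-≤ λ x → ∑-mono-≤ λ y → pointwise x y
    where
    pointwise : ∀ x y → when (A x ∧ not (A y)) (h x y) ≤ when (A x ∧ not (A y)) (h′ x y)
    pointwise x y with A x in ax | A y in ay
    ... | true  | false = h≤h′ x y ax ay
    ... | true  | true  = ℚ.≤-refl
    ... | false | _     = ℚ.≤-refl

  crossing-≗ : ∀ {h A′} → (∀ x → A x ≡ A′ x) → crossing h A ≡ crossing h A′
  crossing-≗ {h} A≗A′ = ∑-cong λ x → ∑-cong λ y →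
    cong₂ (λ a b → when (a ∧ not b) (h x y)) (A≗A′ x) (A≗A′ y)

  crossing-zero : ∀ {h} → Leaves (λ x y → h x y ≡ 0ℚ) → crossing h A ≡ 0ℚ
  crossing-zero h≡0 = trans (crossing-cong h≡0)
    (∑-zero _ λ x → ∑-zero _ λ y → when-zero (A x ∧ not (A y)))

  crossing-nonneg : ∀ {h} → Leaves (λ x y → 0ℚ ≤ h x y) → 0ℚ ≤ crossing h A
  crossing-nonneg h≥0 = subst (_≤ crossing _ A) (crossing-zero (λ _ _ _ _ → refl)) (crossing-mono-≤ h≥0)

∉⇒lookup≡false : ∀ {n} {p : Subset n} {x} → x ∉ p → lookup p x ≡ false
∉⇒lookup≡false {p = p} {x} x∉p with lookup p x in e
... | true  = contradiction (lookup⇒[]= x p e) x∉p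
... | false = refl

∈-tabulate⁺ : ∀ {n} {f : Fin n → Bool} {x} → f x ≡ true → x ∈ tabulate f
∈-tabulate⁺ {f = f} {x} fx≡true = lookup⇒[]= x (tabulate f) (trans (lookup∘tabulate f x) fx≡true)

∈-tabulate⁻ : ∀ {n} {f : Fin n → Bool} {x} → x ∈ tabulate f → f x ≡ true
∈-tabulate⁻ {f = f} {x} x∈ = trans (sym (lookup∘tabulate f x)) ([]=⇒lookup x∈)

∉-tabulate⁺ : ∀ {n} {f : Fin n → Bool} {x} → f x ≡ false → x ∉ tabulate f
∉-tabulate⁺ fx≡false x∈ = contradiction (trans (sym (∈-tabulate⁻ x∈)) fx≡false) λ ()

does≡true⇒ : ∀ {p} {P : Set p} (P? : Dec P) → does P? ≡ true → P
does≡true⇒ (yes p) _ = p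

does≡false⇒¬ : ∀ {p} {P : Set p} (P? : Dec P) → does P? ≡ false → ¬ P
does≡false⇒¬ (no ¬p) _ = ¬p

module _ {m} {ℓ : Level} (R : ℕ → Pred (Fin m) ℓ) (R? : ∀ k → Decidable (R k))
         (R-grows : ∀ k → R k ⊆ R (suc k)) where

  private
    toSubset : ℕ → Subset m
    toSubset k = tabulate (λ z → does (R? k z))

    ∈-toSubset⁺ : ∀ {k z} → R k z → z ∈ toSubset k
    ∈-toSubset⁺ {k} {z} r = ∈-tabulate⁺ (dec-true (R? k z) r)

    ∈-toSubset⁻ : ∀ {k z} → z ∈ toSubset k → R k z
    ∈-toSubset⁻ {k} {z} z∈ = does≡true⇒ (R? k z) (∈-tabulate⁻ z∈)

    stalls-or-grows : ∀ k → (∃[ j ] R (suc j) ⊆ R j) ⊎ k ℕ.≤ ∣ toSubset k ∣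
    stalls-or-grows zero = inj₂ ℕ.z≤n
    stalls-or-grows (suc k) with stalls-or-grows k
    ... | inj₁ stall = inj₁ stall
    ... | inj₂ k≤∣Rk∣ with all? (λ z → R? (suc k) z →-dec R? k z)
    ...   | yes stalled = inj₁ (k , λ {z} → stalled z)
    ...   | no ¬stalled with ¬∀⟶∃¬ m _ (λ z → R? (suc k) z →-dec R? k z) ¬stalled
    ...     | z , new = inj₂ (ℕ.≤-trans (ℕ.s≤s k≤∣Rk∣) (p⊂q⇒∣p∣<∣q∣ strict))
      where
      strict : toSubset k Subset.⊂ toSubset (suc k)
      strict = (λ z∈ → ∈-toSubset⁺ (R-grows k (∈-toSubset⁻ z∈)))
             , z
             , ∈-toSubset⁺ (decidable-stable (R? (suc k) z) λ ¬r → new λ r → contradiction r ¬r)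
             , λ z∈ → new λ _ → ∈-toSubset⁻ z∈

  increasing-chain-stabilises : ∃[ j ] R (suc j) ⊆ R j
  increasing-chain-stabilises with stalls-or-grows (suc m)
  ... | inj₁ stall = stall
  ... | inj₂ too-big = contradiction (ℕ.≤-trans too-big (∣p∣≤n (toSubset (suc m)))) ℕ.1+n≰n

module _ {n} (T : Digraph n) where

  component-closed : ∀ {S W x y} → IsComponent T S W → x ∈ W → Conn T S x y → y ∈ W
  component-closed W-comp x∈W (here _)             = x∈W
  component-closed W-comp x∈W (step x~y y-z z∈S) =
    IsComponent.closed W-comp (component-closed W-comp x∈W x~y) z∈S y-z

  components-unique : ∀ {S W W′ x} → IsComponent T S W → IsComponent T S W′ →
                      x ∈ W → x ∈ W′ → W ≡ W′
  components-unique W-comp W′-comp x∈W x∈W′ = ⊆-antisym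
    (λ y∈W → component-closed W′-comp x∈W′ (IsComponent.connected W-comp x∈W y∈W))
    (λ y∈W′ → component-closed W-comp x∈W (IsComponent.connected W′-comp x∈W′ y∈W′))

module _ {n} {T : Digraph n} {s : Fin n} {χ : ℕ → Subset n → Fin n} where

  private
    child⊆parent : ∀ {i U W x} → IsComponent T (U Subset.- χ i U) W → x ∈ W → x ∈ U
    child⊆parent {i} {U} W-comp x∈W = p─q⊆p U ⁅ χ i U ⁆ (IsComponent.sub W-comp x∈W)

  parts-unique : ∀ {i W W′ x} → P T s χ i W → P T s χ i W′ → x ∈ W → x ∈ W′ → W ≡ W′
  parts-unique (P₁ W-comp) (P₁ W′-comp) x∈W x∈W′ = components-unique T W-comp W′-comp x∈W x∈W′
  parts-unique (Pstep U∈P W-comp) (Pstep U′∈P W′-comp) x∈W x∈W′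
    with refl ← parts-unique U∈P U′∈P (child⊆parent W-comp x∈W) (child⊆parent W′-comp x∈W′)
    = components-unique T W-comp W′-comp x∈W x∈W′
  parts-unique (P₁ _)      (Pstep () _) _ _
  parts-unique (Pstep () _) (P₁ _)      _ _

  source∉part : ∀ {i W x} → P T s χ i W → x ∈ W → x ≢ s
  source∉part (P₁ W-comp)       x∈W = x∉⁅y⁆⇒x≢y (x∈∁p⇒x∉p (IsComponent.sub W-comp x∈W))
  source∉part (Pstep U∈P W-comp) x∈W = source∉part U∈P (child⊆parent W-comp x∈W)

module Network {n} (w : Weights n) (s : Fin n) (T : Digraph n)
               (χ : ℕ → Subset n → Fin n) (i : ℕ) where

  Inner : Fin n → Fin n → Set
  Inner = SamePart T s χ i

  Cᵢ : Fin n → Set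
  Cᵢ = C T s χ i

  inflow outflow : Flow n → Fin n → ℚ
  inflow  g v = ∑ (λ x → e₁ g x v) + ∑ (λ x → e₂ g x v)
  outflow g v = ∑ (λ y → e₁ g v y) + e₃ g v

  record Preflow (g : Flow n) (excess : Fin n → ℚ) : Set where
    field
      e₁-nonneg : ∀ x y → 0ℚ ≤ e₁ g x y
      e₁-cap    : ∀ x y → e₁ g x y ≤ w x y
      e₁-none   : ∀ x y → ¬ Inner x y → e₁ g x y ≡ 0ℚ
      e₂-nonneg : ∀ x v → 0ℚ ≤ e₂ g x v
      e₂-cap    : ∀ x v → e₂ g x v ≤ w x v
      e₂-none   : ∀ x v → Inner x v → e₂ g x v ≡ 0ℚ
      e₃-nonneg : ∀ u → 0ℚ ≤ e₃ g u
      e₃-none   : ∀ u → ¬ Cᵢ u → e₃ g u ≡ 0ℚ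
      conserve  : ∀ v → v ≢ s → inflow g v ≡ outflow g v + excess v

  pushE₁ pushE₂ : Flow n → Fin n → Fin n → ℚ → Flow n
  pushE₁ g a b c = record g { e₁ = λ x y → e₁ g x y + point₂ a b c x y }
  pushE₂ g a b c = record g { e₂ = λ x y → e₂ g x y + point₂ a b c x y }

  pushE₃ : Flow n → Fin n → ℚ → Flow n
  pushE₃ g z c = record g { e₃ = λ y → e₃ g y + point z c y }

  inflow-pushE₁ : ∀ g a b c v → inflow (pushE₁ g a b c) v ≡ inflow g v + point b c v
  inflow-pushE₁ g a b c v = trans
    (cong (_+ ∑ (λ x → e₂ g x v)) (trans (∑-distrib-+ (λ x → e₁ g x v) _)
                                         (cong (∑ (λ x → e₁ g x v) +_) (∑-point₂ˡ a b c v))))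
    (xy∙z≈xz∙y (∑ (λ x → e₁ g x v)) (point b c v) (∑ (λ x → e₂ g x v)))

  outflow-pushE₁ : ∀ g a b c v → outflow (pushE₁ g a b c) v ≡ outflow g v + point a c v
  outflow-pushE₁ g a b c v = trans
    (cong (_+ e₃ g v)
          (trans (∑-distrib-+ (e₁ g v) _) (cong (∑ (e₁ g v) +_) (∑-point₂ʳ a b c v))))
    (xy∙z≈xz∙y (∑ (e₁ g v)) (point a c v) (e₃ g v))

  inflow-pushE₂ : ∀ g a b c v → inflow (pushE₂ g a b c) v ≡ inflow g v + point b c v
  inflow-pushE₂ g a b c v = trans
    (cong (∑ (λ x → e₁ g x v) +_) (trans (∑-distrib-+ (λ x → e₂ g x v) _)
                                         (cong (∑ (λ x → e₂ g x v) +_) (∑-point₂ˡ a b c v))))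
    (sym (ℚ.+-assoc (∑ (λ x → e₁ g x v)) (∑ (λ x → e₂ g x v)) (point b c v)))

  value-pushE₃ : ∀ g z c → value (pushE₃ g z c) ≡ value g + c
  value-pushE₃ g z c = trans (∑-distrib-+ (e₃ g) (point z c)) (cong (value g +_) (∑-point z c))

  pushE₁-Preflow : ∀ {g excess excess′ a b c} → Preflow g excess → Inner a b →
                   0ℚ ≤ e₁ g a b + c → e₁ g a b + c ≤ w a b →
                   (∀ v → excess v + point b c v ≡ point a c v + excess′ v) →
                   Preflow (pushE₁ g a b c) excess′
  pushE₁-Preflow {g} {excess} {excess′} {a} {b} {c} pre ab 0≤ab ab≤w moved = record
    { e₁-nonneg = +-point₂-elim (λ _ _ q → 0ℚ ≤ q) 0≤ab e₁-nonneg
    ; e₁-cap    = +-point₂-elim (λ x y q → q ≤ w x y) ab≤w e₁-cap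
    ; e₁-none   = +-point₂-elim (λ x y q → ¬ Inner x y → q ≡ 0ℚ) (contradiction ab) e₁-none
    ; e₂-nonneg = e₂-nonneg ; e₂-cap = e₂-cap ; e₂-none = e₂-none
    ; e₃-nonneg = e₃-nonneg ; e₃-none = e₃-none
    ; conserve  = conserve′ }
    where
    open Preflow pre
    open ≡-Reasoning
    conserve′ : ∀ v → v ≢ s → inflow (pushE₁ g a b c) v ≡ outflow (pushE₁ g a b c) v + excess′ v
    conserve′ v v≢s = begin
      inflow (pushE₁ g a b c) v                 ≡⟨ inflow-pushE₁ g a b c v ⟩
      inflow g v + point b c v                  ≡⟨ cong (_+ point b c v) (conserve v v≢s) ⟩
      outflow g v + excess v + point b c v      ≡⟨ ℚ.+-assoc (outflow g v) (excess v) (point b c v) ⟩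
      outflow g v + (excess v + point b c v)    ≡⟨ cong (outflow g v +_) (moved v) ⟩
      outflow g v + (point a c v + excess′ v)   ≡⟨ sym (ℚ.+-assoc (outflow g v) (point a c v) (excess′ v)) ⟩
      outflow g v + point a c v + excess′ v     ≡⟨ cong (_+ excess′ v) (sym (outflow-pushE₁ g a b c v)) ⟩
      outflow (pushE₁ g a b c) v + excess′ v    ∎

  pushE₂-Preflow : ∀ {f x z c} → Feasible w T s χ i f → ¬ Inner x z →
                   0ℚ ≤ e₂ f x z + c → e₂ f x z + c ≤ w x z →
                   Preflow (pushE₂ f x z c) (point z c)
  pushE₂-Preflow {f} {x} {z} {c} feasible ¬xz 0≤xz xz≤w = record
    { e₁-nonneg = e₁-nonneg ; e₁-cap = e₁-cap ; e₁-none = e₁-none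
    ; e₂-nonneg = +-point₂-elim (λ _ _ q → 0ℚ ≤ q) 0≤xz e₂-nonneg
    ; e₂-cap    = +-point₂-elim (λ x y q → q ≤ w x y) xz≤w e₂-cap
    ; e₂-none   = +-point₂-elim (λ x y q → Inner x y → q ≡ 0ℚ) (λ xz → contradiction xz ¬xz) e₂-none
    ; e₃-nonneg = e₃-nonneg ; e₃-none = e₃-none
    ; conserve  = λ v v≢s → trans (inflow-pushE₂ f x z c v) (cong (_+ point z c v) (conserve v v≢s)) }
    where open Feasible feasible

  pushE₃-Feasible : ∀ {g z c} → Preflow g (point z c) → Cᵢ z → 0ℚ ≤ c →
                    Feasible w T s χ i (pushE₃ g z c)
  pushE₃-Feasible {g} {z} {c} pre z∈C 0≤c = record
    { e₁-nonneg = e₁-nonneg ; e₁-cap = e₁-cap ; e₁-none = e₁-none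
    ; e₂-nonneg = e₂-nonneg ; e₂-cap = e₂-cap ; e₂-none = e₂-none
    ; e₃-nonneg = λ y → +-nonneg (e₃-nonneg y) (when-nonneg ⌊ y ≟ z ⌋ 0≤c)
    ; e₃-none   = λ y y∉C → trans (cong (e₃ g y +_) (point-≢ z c λ { refl → y∉C z∈C }))
                                  (trans (ℚ.+-identityʳ _) (e₃-none y y∉C))
    ; conserve  = λ v v≢s → trans (conserve v v≢s) (ℚ.+-assoc (∑ (e₁ g v)) (e₃ g v) (point z c v)) }
    where open Preflow pre

  through : Flow n → Fin n → Fin n → ℚ
  through g x v = e₁ g x v + e₂ g x v

  module _ {g} (feasible : Feasible w T s χ i g) where
    open Feasible feasible

    through-inner : ∀ {x v} → Inner x v → through g x v ≡ e₁ g x v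
    through-inner {x} {v} xv = trans (cong (e₁ g x v +_) (e₂-none x v xv)) (ℚ.+-identityʳ _)

    through-outer : ∀ {x v} → ¬ Inner x v → through g x v ≡ e₂ g x v
    through-outer {x} {v} ¬xv = trans (cong (_+ e₂ g x v) (e₁-none x v ¬xv)) (ℚ.+-identityˡ _)

  module Part (χ∈ : ∀ {W} → P T s χ i W → χ i W ∈ W) {U : Subset n} (U∈P : P T s χ i U) where

    u : Fin n
    u = χ i U

    u∈U : u ∈ U
    u∈U = χ∈ U∈P

    u∈C : Cᵢ u
    u∈C = U , U∈P , refl

    inner : ∀ {x v} → x ∈ U → v ∈ U → Inner x v
    inner x∈U v∈U = U , U∈P , x∈U , v∈U

    inner-tail : ∀ {x v} → Inner x v → v ∈ U → x ∈ U
    inner-tail (W , W∈P , x∈W , v∈W) v∈U with refl ← parts-unique W∈P U∈P v∈W v∈U = x∈W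

    inner-head : ∀ {x v} → Inner x v → x ∈ U → v ∈ U
    inner-head (W , W∈P , x∈W , v∈W) x∈U with refl ← parts-unique W∈P U∈P x∈W x∈U = v∈W

    sink-unique : ∀ {y} → Cᵢ y → y ∈ U → y ≡ u
    sink-unique (W , W∈P , refl) y∈U with refl ← parts-unique W∈P U∈P (χ∈ W∈P) y∈U = refl

    through≤capacity : ∀ {g} → Feasible w T s χ i g → ∀ x {v} → v ∈ U → through g x v ≤ w x v
    through≤capacity {g} feasible x {v} v∈U with x ∈? U
    ... | yes x∈U = subst (_≤ w x v) (sym (through-inner feasible (inner x∈U v∈U)))
                          (Feasible.e₁-cap feasible x v)
    ... | no x∉U  = subst (_≤ w x v) (sym (through-outer feasible (x∉U ∘ flip inner-tail v∈U)))
                          (Feasible.e₂-cap feasible x v)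

    record Admissibleᵇ (A : Fin n → Bool) : Set where
      field
        sink-side⊆U : ∀ x → A x ≡ false → x ∈ U
        u-sink-side : A u ≡ false

    module _ {g} (feasible : Feasible w T s χ i g) {A} (A-adm : Admissibleᵇ A) where
      open Feasible feasible
      open Admissibleᵇ A-adm
      open ≡-Reasoning

      -- The E₁-flow inside the sink side: it occurs on both sides of the summed conservation law.
      internal : ℚ
      internal = ∑ λ x → ∑ λ y → when (not (A x) ∧ not (A y)) (e₁ g x y)

      inflow-sink-side : ∑ (λ v → when (not (A v)) (inflow g v)) ≡ internal + crossing (through g) A
      inflow-sink-side = begin
        ∑ (λ v → when (not (A v)) (inflow g v))
          ≡⟨ ∑-cong (λ v → split-inflow v) ⟩
        ∑ (λ v → ∑ λ x → in-internal x v + in-crossing x v)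
          ≡⟨ ∑-cong (λ v → ∑-distrib-+ (λ x → in-internal x v) (λ x → in-crossing x v)) ⟩
        ∑ (λ v → ∑ (λ x → in-internal x v) + ∑ (λ x → in-crossing x v))
          ≡⟨ ∑-distrib-+ (λ v → ∑ λ x → in-internal x v) (λ v → ∑ λ x → in-crossing x v) ⟩
        ∑ (λ v → ∑ λ x → in-internal x v) + ∑ (λ v → ∑ λ x → in-crossing x v)
          ≡⟨ cong₂ _+_ (∑-comm (λ v x → in-internal x v)) (∑-comm (λ v x → in-crossing x v)) ⟩
        internal + crossing (through g) A ∎
        where
        in-internal in-crossing : Fin n → Fin n → ℚ
        in-internal x v = when (not (A x) ∧ not (A v)) (e₁ g x v)
        in-crossing x v = when (A x ∧ not (A v)) (through g x v)

        split-edge : ∀ x v → when (not (A v)) (e₁ g x v) + when (not (A v)) (e₂ g x v)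
                             ≡ in-internal x v + in-crossing x v
        split-edge x v with A x in ax | A v in av
        ... | false | false = cong (e₁ g x v +_) (e₂-none x v (inner (sink-side⊆U x ax) (sink-side⊆U v av)))
        ... | true  | false = sym (ℚ.+-identityˡ _)
        ... | false | true  = refl
        ... | true  | true  = refl

        split-inflow : ∀ v → when (not (A v)) (inflow g v) ≡ ∑ λ x → in-internal x v + in-crossing x v
        split-inflow v = begin
          when (not (A v)) (inflow g v)
            ≡⟨ when-+ (not (A v)) _ _ ⟩
          when (not (A v)) (∑ λ x → e₁ g x v) + when (not (A v)) (∑ λ x → e₂ g x v)
            ≡⟨ cong₂ _+_ (when-∑ (not (A v)) (λ x → e₁ g x v))
                         (when-∑ (not (A v)) (λ x → e₂ g x v)) ⟩
          ∑ (λ x → in-e₁ x) + ∑ (λ x → in-e₂ x)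
            ≡⟨ sym (∑-distrib-+ in-e₁ in-e₂) ⟩
          ∑ (λ x → in-e₁ x + in-e₂ x)
            ≡⟨ ∑-cong (λ x → split-edge x v) ⟩
          ∑ (λ x → in-internal x v + in-crossing x v) ∎
          where
          in-e₁ in-e₂ : Fin n → ℚ
          in-e₁ x = when (not (A v)) (e₁ g x v)
          in-e₂ x = when (not (A v)) (e₂ g x v)

      outflow-sink-side : ∑ (λ v → when (not (A v)) (outflow g v))
                          ≡ internal + crossing (e₁ g) (not ∘ A) + e₃ g u
      outflow-sink-side = begin
        ∑ (λ v → when (not (A v)) (outflow g v))
          ≡⟨ ∑-cong (λ v → when-+ (not (A v)) (∑ (e₁ g v)) (e₃ g v)) ⟩
        ∑ (λ v → when (not (A v)) (∑ (e₁ g v)) + when (not (A v)) (e₃ g v))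
          ≡⟨ ∑-distrib-+ (λ v → when (not (A v)) (∑ (e₁ g v))) (λ v → when (not (A v)) (e₃ g v)) ⟩
        ∑ (λ v → when (not (A v)) (∑ (e₁ g v))) + ∑ (λ v → when (not (A v)) (e₃ g v))
          ≡⟨ cong₂ _+_ split-outflow (trans (∑-cong only-u) (∑-point u (e₃ g u))) ⟩
        internal + crossing (e₁ g) (not ∘ A) + e₃ g u ∎
        where
        out-internal out-crossing : Fin n → Fin n → ℚ
        out-internal v y = when (not (A v) ∧ not (A y)) (e₁ g v y)
        out-crossing v y = when (not (A v) ∧ not (not (A y))) (e₁ g v y)

        split-outflow : ∑ (λ v → when (not (A v)) (∑ (e₁ g v))) ≡ internal + crossing (e₁ g) (not ∘ A)
        split-outflow = begin
          ∑ (λ v → when (not (A v)) (∑ (e₁ g v)))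
            ≡⟨ ∑-cong (λ v → trans (when-∑ (not (A v)) (e₁ g v))
                                   (∑-cong λ y → when-split (not (A v)) (not (A y)) (e₁ g v y))) ⟩
          ∑ (λ v → ∑ λ y → out-internal v y + out-crossing v y)
            ≡⟨ ∑-cong (λ v → ∑-distrib-+ (out-internal v) (out-crossing v)) ⟩
          ∑ (λ v → ∑ (out-internal v) + ∑ (out-crossing v))
            ≡⟨ ∑-distrib-+ (λ v → ∑ (out-internal v)) (λ v → ∑ (out-crossing v)) ⟩
          internal + crossing (e₁ g) (not ∘ A) ∎

        only-u : ∀ v → when (not (A v)) (e₃ g v) ≡ point u (e₃ g u) v
        only-u v with v ≟ u
        ... | yes refl rewrite u-sink-side = refl
        ... | no v≢u with A v in av
        ...   | true  = refl
        ...   | false = e₃-none v λ v∈C → v≢u (sink-unique v∈C (sink-side⊆U v av))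

      flow-balance : crossing (through g) A ≡ crossing (e₁ g) (not ∘ A) + e₃ g u
      flow-balance = ∙-cancelˡ internal _ _ (begin
        internal + crossing (through g) A              ≡⟨ sym inflow-sink-side ⟩
        ∑ (λ v → when (not (A v)) (inflow g v))        ≡⟨ ∑-cong conserved ⟩
        ∑ (λ v → when (not (A v)) (outflow g v))       ≡⟨ outflow-sink-side ⟩
        internal + crossing (e₁ g) (not ∘ A) + e₃ g u  ≡⟨ ℚ.+-assoc internal _ _ ⟩
        internal + (crossing (e₁ g) (not ∘ A) + e₃ g u) ∎)
        where
        conserved : ∀ v → when (not (A v)) (inflow g v) ≡ when (not (A v)) (outflow g v)
        conserved v with A v in av
        ... | false = conserve v (source∉part U∈P (sink-side⊆U v av))
        ... | true  = refl

    admissibleᵇ : ∀ {A} → Admissible U u A → Admissibleᵇ (lookup A)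
    admissibleᵇ {A} (V∖U⊆A , u∉A) = record
      { sink-side⊆U = sink-side⊆U
      ; u-sink-side = ∉⇒lookup≡false u∉A }
      where
      sink-side⊆U : ∀ x → lookup A x ≡ false → x ∈ U
      sink-side⊆U x Ax≡false with x ∈? U
      ... | yes x∈U = x∈U
      ... | no x∉U  = contradiction (trans (sym ([]=⇒lookup (V∖U⊆A x x∉U))) Ax≡false) λ ()

    weak-duality : ∀ {g A} → Feasible w T s χ i g → Admissible U u A → e₃ g u ≤ cutWeight w A
    weak-duality {g} {A} feasible A-adm = begin
      e₃ g u                                     ≤⟨ p≤q+p (crossing-nonneg {A = not ∘ lookup A} λ x y _ _ →
                                                                           e₁-nonneg x y) ⟩
      crossing (e₁ g) (not ∘ lookup A) + e₃ g u  ≡⟨ sym (flow-balance feasible A-admᵇ) ⟩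
      crossing (through g) (lookup A)            ≤⟨ crossing-mono-≤ through≤w ⟩
      cutWeight w A                              ∎
      where
      open Feasible feasible
      open ℚ.≤-Reasoning
      A-admᵇ = admissibleᵇ A-adm
      through≤w : Leaves (λ x y → through g x y ≤ w x y)
      through≤w x y _ Ay≡false = through≤capacity feasible x (Admissibleᵇ.sink-side⊆U A-admᵇ y Ay≡false)

    module MaxFlow {f} (max : IsMaxFlow w T s χ i f) where
      open IsMaxFlow max using (feasible; maximal)
      open Feasible feasible

      Source : Fin n → Set
      Source z = ∃[ x ] (x ∉ U × e₂ f x z < w x z)

      Residual : Fin n → Fin n → Set
      Residual v z = e₁ f v z < w v z ⊎ 0ℚ < e₁ f z v

      Reached : ℕ → Fin n → Set
      Reached zero    z = ⊥
      Reached (suc k) z = Reached k z ⊎ (z ∈ U × (Source z ⊎ ∃[ v ] (Reached k v × Residual v z)))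

      reached? : ∀ k → Decidable (Reached k)
      reached? zero    z = no λ ()
      reached? (suc k) z =
        reached? k z ⊎-dec (z ∈? U ×-dec (source? ⊎-dec any? λ v → reached? k v ×-dec residual? v))
        where
        source? = any? λ x → ¬? (x ∈? U) ×-dec (e₂ f x z ℚ.<? w x z)
        residual? = λ v → (e₁ f v z ℚ.<? w v z) ⊎-dec (0ℚ ℚ.<? e₁ f z v)

      reached⊆U : ∀ {k z} → Reached k z → z ∈ U
      reached⊆U {suc k} (inj₁ z-reached) = reached⊆U z-reached
      reached⊆U {suc k} (inj₂ (z∈U , _)) = z∈U

      -- Augmenting paths are built level by level, so the edge by which a new vertex is reached
      -- has not yet been touched by the pushes along the path to its predecessor.
      record Agrees (k : ℕ) (g : Flow n) : Set where
        field
          same-value : value g ≡ value f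
          same-e₁    : ∀ a b → ¬ (Reached k a × Reached k b) → e₁ g a b ≡ e₁ f a b

      agrees-suc : ∀ {k g} → Agrees k g → Agrees (suc k) g
      agrees-suc agrees = record
        { same-value = same-value
        ; same-e₁    = λ a b ¬both → same-e₁ a b λ (ra , rb) → ¬both (inj₁ ra , inj₁ rb) }
        where open Agrees agrees

      agrees-pushE₁ : ∀ {k g a b c} → Agrees k g → Reached (suc k) a → Reached (suc k) b →
                      Agrees (suc k) (pushE₁ g a b c)
      agrees-pushE₁ {g = g} {a} {b} {c} agrees a-reached b-reached = record
        { same-value = Agrees.same-value agrees
        ; same-e₁    = λ x y ¬both →
            trans (+-point₂-≢ a b c {x} {y} (e₁ g x y) λ { (refl , refl) → ¬both (a-reached , b-reached) })
                  (Agrees.same-e₁ (agrees-suc agrees) x y ¬both) }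

      -- Every small enough amount ε > 0 of additional flow can be routed from s to z.
      Deliverable : ℕ → Fin n → Set
      Deliverable k z = ∃[ δ ] (0ℚ < δ × (∀ ε → 0ℚ < ε → ε ≤ δ →
                                ∃[ g ] (Preflow g (point z ε) × Agrees k g)))

      deliverable-suc : ∀ {k z} → Deliverable k z → Deliverable (suc k) z
      deliverable-suc (δ , 0<δ , deliver) = δ , 0<δ , λ ε 0<ε ε≤δ →
        let g , pre , agrees = deliver ε 0<ε ε≤δ in g , pre , agrees-suc agrees

      deliverable-source : ∀ {k z} → z ∈ U → Source z → Deliverable k z
      deliverable-source {z = z} z∈U (x , x∉U , unsaturated) =
        w x z - e₂ f x z , p<q⇒0<q-p unsaturated , λ ε 0<ε ε≤slack →
          pushE₂ f x z ε
        , pushE₂-Preflow feasible (x∉U ∘ flip inner-tail z∈U) (+-nonneg (e₂-nonneg x z) (ℚ.<⇒≤ 0<ε))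
            (p+r≤q (e₂ f x z) ε≤slack)
        , record { same-value = refl ; same-e₁ = λ _ _ _ → refl }

      deliverable-forward : ∀ {k v z} → Reached k v → Deliverable k v → z ∈ U → ¬ Reached k z →
                            e₁ f v z < w v z → Deliverable (suc k) z
      deliverable-forward {k} {v} {z} v-reached (δ , 0<δ , deliver) z∈U z-new unsaturated =
        δ ⊓ slack , 0<⊓ 0<δ (p<q⇒0<q-p unsaturated) , λ ε 0<ε ε≤δ′ →
          let g , pre , agrees = deliver ε 0<ε (ℚ.≤-trans ε≤δ′ (ℚ.p⊓q≤p δ slack))
              unchanged = Agrees.same-e₁ agrees v z (z-new ∘ proj₂)
          in pushE₁ g v z ε
           , pushE₁-Preflow pre (inner (reached⊆U v-reached) z∈U)
               (+-nonneg (Preflow.e₁-nonneg pre v z) (ℚ.<⇒≤ 0<ε))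
               (subst (λ q → q + ε ≤ w v z) (sym unchanged)
                 (p+r≤q (e₁ f v z) (ℚ.≤-trans ε≤δ′ (ℚ.p⊓q≤q δ slack))))
               (λ _ → refl)
           , agrees-pushE₁ agrees (inj₁ v-reached) (inj₂ (z∈U , inj₂ (v , v-reached , inj₁ unsaturated)))
        where
        slack = w v z - e₁ f v z

      deliverable-backward : ∀ {k v z} → Reached k v → Deliverable k v → z ∈ U → ¬ Reached k z →
                             0ℚ < e₁ f z v → Deliverable (suc k) z
      deliverable-backward {k} {v} {z} v-reached (δ , 0<δ , deliver) z∈U z-new positive =
        δ ⊓ e₁ f z v , 0<⊓ 0<δ positive , λ ε 0<ε ε≤δ′ →
          let g , pre , agrees = deliver ε 0<ε (ℚ.≤-trans ε≤δ′ (ℚ.p⊓q≤p δ (e₁ f z v)))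
              unchanged = Agrees.same-e₁ agrees z v (z-new ∘ proj₁)
          in pushE₁ g z v (- ε)
           , pushE₁-Preflow pre (inner z∈U (reached⊆U v-reached))
               (subst (λ q → 0ℚ ≤ q - ε) (sym unchanged)
                 (p≤q⇒0≤q-p (ℚ.≤-trans ε≤δ′ (ℚ.p⊓q≤q δ (e₁ f z v)))))
               (ℚ.≤-trans (p-q≤p (e₁ g z v) (ℚ.<⇒≤ 0<ε)) (Preflow.e₁-cap pre z v))
               (λ y → trans (point-+-neg v ε y)
                            (sym (trans (ℚ.+-comm (point z (- ε) y) (point z ε y)) (point-+-neg z ε y))))
           , agrees-pushE₁ agrees (inj₂ (z∈U , inj₂ (v , v-reached , inj₂ positive))) (inj₁ v-reached)

      reached⇒deliverable : ∀ k {z} → Reached k z → Deliverable k z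
      reached⇒deliverable (suc k) {z} z-reached with reached? k z
      ... | yes z-old = deliverable-suc (reached⇒deliverable k z-old)
      ... | no z-new with z-reached
      ...   | inj₁ z-old                                   = contradiction z-old z-new
      ...   | inj₂ (z∈U , inj₁ source)                      = deliverable-source z∈U source
      ...   | inj₂ (z∈U , inj₂ (v , v-reached , inj₁ fwd)) =
        deliverable-forward v-reached (reached⇒deliverable k v-reached) z∈U z-new fwd
      ...   | inj₂ (z∈U , inj₂ (v , v-reached , inj₂ bwd)) =
        deliverable-backward v-reached (reached⇒deliverable k v-reached) z∈U z-new bwd

      u-unreached : ∀ k → ¬ Reached k u
      u-unreached k u-reached =
        let δ , 0<δ , deliver = reached⇒deliverable k u-reached
            g , pre , agrees  = deliver δ 0<δ ℚ.≤-refl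
            augmented = pushE₃ g u δ
            larger : value f < value augmented
            larger = begin-strict
              value f             ≡⟨ sym (ℚ.+-identityʳ (value f)) ⟩
              value f + 0ℚ        <⟨ ℚ.+-monoʳ-< (value f) 0<δ ⟩
              value f + δ         ≡⟨ cong (_+ δ) (sym (Agrees.same-value agrees)) ⟩
              value g + δ         ≡⟨ sym (value-pushE₃ g u δ) ⟩
              value augmented     ∎
        in ℚ.<-irrefl refl
             (ℚ.<-≤-trans larger (maximal augmented (pushE₃-Feasible pre u∈C (ℚ.<⇒≤ 0<δ))))
        where open ℚ.≤-Reasoning

      private
        stable : ∃[ j ] Reached (suc j) ⊆ Reached j
        stable = increasing-chain-stabilises Reached reached? (λ _ → inj₁)

      Reachable : Fin n → Set
      Reachable = Reached (proj₁ stable)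

      source-closed : ∀ {z} → z ∈ U → Source z → Reachable z
      source-closed z∈U source = proj₂ stable (inj₂ (z∈U , inj₁ source))

      residual-closed : ∀ {v z} → Reachable v → z ∈ U → Residual v z → Reachable z
      residual-closed v-reachable z∈U residual = proj₂ stable (inj₂ (z∈U , inj₂ (_ , v-reachable , residual)))

      SourceSide : Fin n → Set
      SourceSide z = z ∉ U ⊎ Reachable z

      sourceSide? : Decidable SourceSide
      sourceSide? z = ¬? (z ∈? U) ⊎-dec reached? (proj₁ stable) z

      sourceSideᵇ : Fin n → Bool
      sourceSideᵇ z = does (sourceSide? z)

      sink-side⇒∈U : ∀ {z} → ¬ SourceSide z → z ∈ U
      sink-side⇒∈U {z} sink with z ∈? U
      ... | yes z∈U = z∈U
      ... | no z∉U  = contradiction (inj₁ z∉U) sink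

      sourceSide-admissibleᵇ : Admissibleᵇ sourceSideᵇ
      sourceSide-admissibleᵇ = record
        { sink-side⊆U = λ x e → sink-side⇒∈U (does≡false⇒¬ (sourceSide? x) e)
        ; u-sink-side = dec-false (sourceSide? u) [ (λ u∉U → u∉U u∈U) , u-unreached _ ] }

      no-backflow : ∀ {x y} → ¬ SourceSide x → SourceSide y → e₁ f x y ≡ 0ℚ
      no-backflow {x} {y} x-sink (inj₁ y∉U) = e₁-none x y (y∉U ∘ flip inner-head (sink-side⇒∈U x-sink))
      no-backflow {x} {y} x-sink (inj₂ y-reachable) = sym (≤∧≮⇒≡ (e₁-nonneg x y) λ positive →
        x-sink (inj₂ (residual-closed y-reachable (sink-side⇒∈U x-sink) (inj₂ positive))))

      saturated : ∀ {x y} → SourceSide x → ¬ SourceSide y → through f x y ≡ w x y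
      saturated {x} {y} (inj₁ x∉U) y-sink =
        trans (through-outer feasible (x∉U ∘ flip inner-tail y∈U))
              (≤∧≮⇒≡ (e₂-cap x y) λ unsaturated →
                 y-sink (inj₂ (source-closed y∈U (x , x∉U , unsaturated))))
        where y∈U = sink-side⇒∈U y-sink
      saturated {x} {y} (inj₂ x-reachable) y-sink =
        trans (through-inner feasible (inner (reached⊆U x-reachable) y∈U))
              (≤∧≮⇒≡ (e₁-cap x y) λ unsaturated →
                 y-sink (inj₂ (residual-closed x-reachable y∈U (inj₁ unsaturated))))
        where y∈U = sink-side⇒∈U y-sink

      minCut : Subset n
      minCut = tabulate sourceSideᵇ

      minCut-admissible : Admissible U u minCut
      minCut-admissible = (λ x x∉U → ∈-tabulate⁺ (dec-true (sourceSide? x) (inj₁ x∉U)))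
                        , ∉-tabulate⁺ (Admissibleᵇ.u-sink-side sourceSide-admissibleᵇ)

      minCut-weight : cutWeight w minCut ≡ e₃ f u
      minCut-weight = begin
        cutWeight w minCut                            ≡⟨ crossing-≗ (lookup∘tabulate sourceSideᵇ) ⟩
        crossing w sourceSideᵇ                        ≡⟨ sym (crossing-cong saturatedᵇ) ⟩
        crossing (through f) sourceSideᵇ              ≡⟨ flow-balance feasible sourceSide-admissibleᵇ ⟩
        crossing (e₁ f) (not ∘ sourceSideᵇ) + e₃ f u
          ≡⟨ cong (_+ e₃ f u) (crossing-zero no-backflowᵇ) ⟩
        0ℚ + e₃ f u                                   ≡⟨ ℚ.+-identityˡ _ ⟩
        e₃ f u                                        ∎
        where
        open ≡-Reasoning
        saturatedᵇ : Leaves (λ x y → through f x y ≡ w x y)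
        saturatedᵇ x y x-source y-sink =
          saturated (does≡true⇒ (sourceSide? x) x-source) (does≡false⇒¬ (sourceSide? y) y-sink)
        no-backflowᵇ : Leaves (λ x y → e₁ f x y ≡ 0ℚ)
        no-backflowᵇ x y x-sink y-source = no-backflow (does≡false⇒¬ (sourceSide? x) (not-injective x-sink))
                                                       (does≡true⇒ (sourceSide? y) (not-injective y-source))

      max-flow-min-cut : IsMinCut w U u (e₃ f u)
      max-flow-min-cut = (minCut , minCut-admissible , minCut-weight) , λ _ → weak-duality feasible

lemma14 : ∀ {n} (w : Weights n) → NonNeg w → (s : Fin n) → (T : Digraph n) →
          IsArborescence w s T →
          (χ : ℕ → Subset n → Fin n) →
          (∀ i U → P T s χ i U → IsCentroid T U (χ i U)) →
          (i : ℕ) → (f : Flow n) → IsMaxFlow w T s χ i f →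
          (U : Subset n) → P T s χ i U →
          IsMinCut w U (χ i U) (e₃ f (χ i U))
lemma14 w _ s T _ χ centroids i f max U U∈P = MaxFlow.max-flow-min-cut max
  where
  open Network w s T χ i
  open Part (λ {W} W∈P → IsCentroid.mem (centroids i W W∈P)) U∈P
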